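{- Let $k\in\mathbb{N}$ and $S=\langle 6k+5,6k+7,6k+11\rangle$. Then (1) $\mathrm{PF}(S)=\{12k^2+28k+9,\ 12k^2+28k+13\}$; (2) $\mathrm{F}(S)=12k^2+28k+13$; (3) $\mathrm{g}(S)=6k^2+16k+8$.
   Context: $\mathbb{N}=\{0,1,2,\dots\}$. For $X\subseteq\mathbb{N}$, $\langle X\rangle$ is the submonoid of $(\mathbb{N},+)$ generated by $X$; here it is a numerical semigroup (submonoid of $\mathbb{N}$ with finite complement). $\mathrm{F}(S)$ is the largest integer not in $S$ (Frobenius number), $\mathrm{g}(S)=|\mathbb{N}\setminus S|$ (genus), and $\mathrm{PF}(S)$ is the set of pseudo-Frobenius numbers: integers $x\notin S$ with $x+s\in S$ for all $s\in S\setminus\{0\}$. -}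

module Defs where

open import Data.Nat using (ℕ; _+_; _*_; _<_)
open import Data.Integer using (ℤ; +_)
open import Data.Product using (Σ; ∃; _×_; _,_)
open import Data.List using (List; length)
open import Data.List.Membership.Propositional using (_∈_)
open import Data.List.Relation.Unary.Unique.Propositional using (Unique)
open import Relation.Binary.PropositionalEquality using (_≡_; _≢_)
open import Relation.Nullary using (¬_)
open import Function.Bundles using (_⇔_)

_∈⟨_,_,_⟩ : ℕ → ℕ → ℕ → ℕ → Set
n ∈⟨ a , b , c ⟩ = ∃ λ x → ∃ λ y → ∃ λ z → x * a + y * b + z * c ≡ n

_∈ℤ⟨_,_,_⟩ : ℤ → ℕ → ℕ → ℕ → Set
m ∈ℤ⟨ a , b , c ⟩ = ∃ λ n → (m ≡ + n) × (n ∈⟨ a , b , c ⟩)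

IsPF : ℕ → ℕ → ℕ → ℤ → Set
IsPF a b c x =
  ¬ (x ∈ℤ⟨ a , b , c ⟩) ×
  (∀ (s : ℕ) → s ∈⟨ a , b , c ⟩ → s ≢ 0 → (x Data.Integer.+ + s) ∈ℤ⟨ a , b , c ⟩)

-- Frobenius number: f ∉ S and every integer larger than f is in S.
-- (For integers below 0 membership fails trivially, so quantifying over ℕ above f suffices.)
IsFrobenius : ℕ → ℕ → ℕ → ℕ → Set
IsFrobenius a b c f = ¬ (f ∈⟨ a , b , c ⟩) × (∀ m → f < m → m ∈⟨ a , b , c ⟩)

HasGenus : ℕ → ℕ → ℕ → ℕ → Set
HasGenus a b c g = Σ (List ℕ) λ L →
  Unique L × (∀ n → (n ∈ L) ⇔ (¬ (n ∈⟨ a , b , c ⟩))) × (length L ≡ g)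

-- With S = ⟨a, a+2, a+6⟩, x·a + y·(a+2) + z·(a+6) = (x+y+z)·a + 2(y+3z), so S consists of the
-- numbers n·a + 2m with (n, m) admissible: m ≤ 3n and m ≠ 3n − 1. For odd a every number other
-- than the odd numbers below a has a unique canonical form n·a + 2m with m < a, and it lies in S
-- iff (n, m) is admissible, since any other representation has smaller n and larger m.
-- For a = 6k+5 everything is read off canonical forms: 12k²+28k+13 = (2k+1)·a + 2(6k+4) and
-- 12k²+28k+9 = (2k+1)·a + 2(6k+2) are inadmissible, while all larger numbers have n ≥ 2k+2 and are
-- admissible. A pseudo-Frobenius number N = p·a + 2m with m < a has (p+1, m) admissible, but one
-- of (p+1, m+1), (p+1, m+3) is not, so N + a + 2 or N + a + 6 can only lie in S through m+1 or
-- m+3 reaching a; this leaves the two numbers above. The gaps are the odd numbers below a together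
-- with the 6k²+13k+6 inadmissible canonical pairs, all of which have n ≤ 2k+1.

module Submission where

open import Defs
open import Data.Nat using (ℕ; _+_; _*_)
open import Data.Integer using (ℤ; +_)
open import Data.Product using (_×_)
open import Data.Sum using (_⊎_)
open import Relation.Binary.PropositionalEquality using (_≡_)
open import Function.Bundles using (_⇔_)

open import Data.Empty using (⊥; ⊥-elim)
open import Data.Integer.Base as Int using (-[1+_])
import Data.Integer.Properties as Intₚ
open import Data.List.Base using (List; []; _∷_; _++_; map; applyUpTo; length)
open import Data.List.Membership.Propositional using (_∈_; _∉_)
open import Data.List.Membership.Propositional.Properties
  using (∈-applyUpTo⁺; ∈-applyUpTo⁻; ∈-map⁺; ∈-map⁻; ∈-++⁺ˡ; ∈-++⁺ʳ; ∈-++⁻)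
open import Data.List.Properties using (length-map; length-applyUpTo; length-++)
open import Data.List.Relation.Unary.All.Properties using (¬Any⇒All¬)
open import Data.List.Relation.Unary.AllPairs using (_∷_)
open import Data.List.Relation.Unary.Any using (here; there)
open import Data.List.Relation.Unary.Unique.Propositional using (Unique)
open import Data.List.Relation.Unary.Unique.Propositional.Properties using (applyUpTo⁺₁; map⁺; ++⁺)
open import Data.Nat.Base
  using (zero; suc; z<s; _≤_; _<_; _≮_; _∸_; z≤n; s≤s; s≤s⁻¹; s<s; s<s⁻¹; NonZero; >-nonZero; >-nonZero⁻¹)
open import Data.Nat.DivMod using (_/_; _%_; m≡m%n+[m/n]*n; m%n<n)
open import Data.Nat.Divisibility using (_∣_; ∣m+n∣m⇒∣n; ∣⇒≤; m∣m*n)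
open import Data.Nat.Properties
open import Data.Nat.Tactic.RingSolver using (solve)
open import Data.Product using (∃; ∃₂; _,_; proj₁; proj₂)
open import Data.Sum using (inj₁; inj₂)
import Data.Sum as Sum
open import Function.Base using (_∘_)
open import Function.Bundles using (mk⇔)
open import Relation.Binary.PropositionalEquality using (_≢_; refl; sym; trans; cong; cong₂; subst)
open import Relation.Nullary using (¬_; yes; no; contradiction)
open import Relation.Nullary.Decidable using (decidable-stable)

open ≤-Reasoning

offset≢multiple : ∀ d {r} → 0 < r → r < d → ∀ x y → d * x + r ≢ d * y
offset≢multiple d {r} 0<r r<d x y eq = <⇒≱ r<d (∣⇒≤ {{>-nonZero 0<r}} d∣r)
  where
  d∣r : d ∣ r
  d∣r = ∣m+n∣m⇒∣n (subst (d ∣_) (sym eq) (m∣m*n y)) (m∣m*n x)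

interval : ℕ → ℕ → List ℕ
interval lo hi = applyUpTo (λ i → lo + i) (hi ∸ lo)

∈-interval⁺ : ∀ {lo hi x} → lo ≤ x → x < hi → x ∈ interval lo hi
∈-interval⁺ {lo} {hi} {x} lo≤x x<hi =
  subst (_∈ interval lo hi) (m+[n∸m]≡n lo≤x) (∈-applyUpTo⁺ (λ i → lo + i) (∸-monoˡ-< x<hi lo≤x))

∈-interval⁻ : ∀ {lo hi x} → x ∈ interval lo hi → lo ≤ x × x < hi
∈-interval⁻ {lo} {hi} x∈ with ∈-applyUpTo⁻ (λ i → lo + i) x∈
... | i , i<hi∸lo , refl =
  m≤m+n lo i , subst (_≤ hi) (cong suc (+-comm i lo)) (m≤o∸n⇒m+n≤o (suc i) lo≤hi i<hi∸lo)
  where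
  lo≤hi : lo ≤ hi
  lo≤hi = <⇒≤ (m∸n≢0⇒n<m (>⇒≢ (≤-<-trans z≤n i<hi∸lo)))

interval-unique : ∀ lo hi → Unique (interval lo hi)
interval-unique lo hi =
  applyUpTo⁺₁ (λ i → lo + i) (hi ∸ lo) λ i<j _ eq → <⇒≢ i<j (+-cancelˡ-≡ lo _ _ eq)

parity : ∀ r → ∃ λ j → r ≡ 2 * j ⊎ r ≡ suc (2 * j)
parity zero = 0 , inj₁ refl
parity (suc r) with parity r
... | j , inj₁ refl = j , inj₂ refl
... | j , inj₂ refl = suc j , inj₁ (solve (j ∷ []))

3x+2y≢1 : ∀ x y → 3 * x + 2 * y ≢ 1
3x+2y≢1 zero y eq = even≢odd y 0 eq
3x+2y≢1 (suc x) y eq = <⇒≱ (s≤s (s≤s z≤n)) (begin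
  3  ≤⟨ *-monoʳ-≤ 3 (s≤s (z≤n {x})) ⟩
  3 * suc x  ≤⟨ m≤m+n (3 * suc x) (2 * y) ⟩
  3 * suc x + 2 * y  ≡⟨ eq ⟩
  1  ∎)

1+[3p+2]≡3[1+p] : ∀ p → suc (3 * p + 2) ≡ 3 * suc p
1+[3p+2]≡3[1+p] p = solve (p ∷ [])

3p+2<3[1+p] : ∀ p → 3 * p + 2 < 3 * suc p
3p+2<3[1+p] p = ≤-reflexive (1+[3p+2]≡3[1+p] p)

3p+4≡1+3[1+p] : ∀ p → 3 * p + 4 ≡ suc (3 * suc p)
3p+4≡1+3[1+p] p = solve (p ∷ [])

3[1+p]<3p+4 : ∀ p → 3 * suc p < 3 * p + 4
3[1+p]<3p+4 p = ≤-reflexive (sym (3p+4≡1+3[1+p] p))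

module Semigroup (a : ℕ) where

  infix 4 _∈S

  _∈S : ℕ → Set
  N ∈S = N ∈⟨ a , a + 2 , a + 6 ⟩

  -- With n = x+y+z generators, the values of y+3z are exactly the m ≤ 3n other than 3n − 1.
  Admissible : ℕ → ℕ → Set
  Admissible n m = m ≤ 3 * n × suc m ≢ 3 * n

  admissible-if-≤ : ∀ {n m} → 2 + m ≤ 3 * n → Admissible n m
  admissible-if-≤ 2+m≤3n = ≤-trans (m≤n+m _ 2) 2+m≤3n , <⇒≢ 2+m≤3n

  ∈S⇒admissible : ∀ {N} → N ∈S → ∃₂ λ n m → Admissible n m × n * a + 2 * m ≡ N
  ∈S⇒admissible (x , y , z , eq) =
    x + y + z , y + 3 * z , (m≤3n , 1+m≢3n) , trans (sym regroup) eq
    where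
    regroup : x * a + y * (a + 2) + z * (a + 6) ≡ (x + y + z) * a + 2 * (y + 3 * z)
    regroup = solve (x ∷ y ∷ z ∷ a ∷ [])
    3n≡m+3x+2y : 3 * (x + y + z) ≡ (y + 3 * z) + (3 * x + 2 * y)
    3n≡m+3x+2y = solve (x ∷ y ∷ z ∷ [])
    m≤3n : y + 3 * z ≤ 3 * (x + y + z)
    m≤3n = subst (y + 3 * z ≤_) (sym 3n≡m+3x+2y) (m≤m+n _ _)
    1+m≢3n : suc (y + 3 * z) ≢ 3 * (x + y + z)
    1+m≢3n eq = 3x+2y≢1 x y (sym (+-cancelˡ-≡ (y + 3 * z) 1 _ (trans (+-comm _ 1) (trans eq 3n≡m+3x+2y))))

  admissible-pred : ∀ {n m} → Admissible (suc n) (3 + m) → Admissible n m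
  admissible-pred {n} {m} (3+m≤ , 4+m≢) =
    s≤s⁻¹ (s≤s⁻¹ (s≤s⁻¹ (subst (3 + m ≤_) (*-suc 3 n) 3+m≤))) ,
    λ eq → 4+m≢ (trans (cong (λ t → 3 + t) eq) (sym (*-suc 3 n)))

  admissible⇒∈S : ∀ n m → Admissible n m → n * a + 2 * m ∈S
  admissible⇒∈S n 0 _ = n , 0 , 0 , solve (n ∷ a ∷ [])
  admissible⇒∈S zero (suc m) (() , _)
  admissible⇒∈S (suc n) 1 _ = n , 1 , 0 , solve (n ∷ a ∷ [])
  admissible⇒∈S (suc zero) 2 (_ , 3≢3) = contradiction refl 3≢3
  admissible⇒∈S (suc (suc n)) 2 _ = n , 2 , 0 , solve (n ∷ a ∷ [])
  admissible⇒∈S (suc n) (suc (suc (suc m))) adm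
    with x , y , z , eq ← admissible⇒∈S n m (admissible-pred adm) = x , y , suc z , (begin-equality
      x * a + y * (a + 2) + (1 + z) * (a + 6)  ≡⟨ solve (x ∷ y ∷ z ∷ a ∷ []) ⟩
      x * a + y * (a + 2) + z * (a + 6) + (a + 6)  ≡⟨ cong (_+ (a + 6)) eq ⟩
      n * a + 2 * m + (a + 6)  ≡⟨ solve (n ∷ m ∷ a ∷ []) ⟩
      (1 + n) * a + 2 * (3 + m)  ∎)

  ∈S⇒≥a : ∀ {N} → N ∈S → N ≢ 0 → a ≤ N
  ∈S⇒≥a N∈S N≢0 with ∈S⇒admissible N∈S
  ... | zero , zero , _ , eq = contradiction (sym eq) N≢0
  ... | suc n , m , _ , refl = ≤-trans (m≤m+n a (n * a)) (m≤m+n _ (2 * m))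

  PF : ℤ → Set
  PF = IsPF a (a + 2) (a + 6)

  ∈ℤ⇒∈S : ∀ {N} → (+ N) ∈ℤ⟨ a , a + 2 , a + 6 ⟩ → N ∈S
  ∈ℤ⇒∈S (n , +N≡+n , n∈S) = subst _∈S (sym (Intₚ.+-injective +N≡+n)) n∈S

  a∈S : a ∈S
  a∈S = 1 , 0 , 0 , solve (a ∷ [])

  a+2∈S : a + 2 ∈S
  a+2∈S = 0 , 1 , 0 , solve (a ∷ [])

  a+6∈S : a + 6 ∈S
  a+6∈S = 0 , 0 , 1 , solve (a ∷ [])

  ∈S-below-a⇒0 : ∀ {n} → n ∈S → n < a → n ≡ 0
  ∈S-below-a⇒0 {zero} _ _ = refl
  ∈S-below-a⇒0 {suc n} n∈S n<a = contradiction (∈S⇒≥a n∈S λ ()) (<⇒≱ n<a)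

  PF-nonnegative : 2 < a → ∀ j → ¬ PF -[1+ j ]
  PF-nonnegative 2<a j (_ , shift) = <⇒≱ 2<a (∈S⇒≥a 2∈S λ ())
    where
    x : ℤ
    x = -[1+ j ]
    a≢0 : a ≢ 0
    a≢0 = >⇒≢ (≤-<-trans z≤n 2<a)
    x+a≡0 : x Int.+ + a ≡ + 0
    x+a≡0 with n , x+a≡n , n∈S ← shift a a∈S a≢0 =
      trans x+a≡n (cong +_ (∈S-below-a⇒0 n∈S n<a))
      where
      n<a : n < a
      n<a = Intₚ.drop‿+<+ (subst (Int._< + a) x+a≡n (Intₚ.+-monoˡ-< (+ a) Int.-<+))
    x+[a+2]≡2 : x Int.+ + (a + 2) ≡ + 2
    x+[a+2]≡2 = trans (cong (λ t → x Int.+ t) (Intₚ.pos-+ a 2))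
               (trans (sym (Intₚ.+-assoc x (+ a) (+ 2))) (cong (λ t → t Int.+ + 2) x+a≡0))
    2∈S : 2 ∈S
    2∈S with n , x+a+2≡n , n∈S ← shift (a + 2) a+2∈S (m+1+n≢0 a) =
      subst _∈S (Intₚ.+-injective (trans (sym x+a+2≡n) x+[a+2]≡2)) n∈S

  gap-above-threshold⇒PF : ∀ {f N} → (∀ M → f < M → M ∈S) → ¬ N ∈S → f < N + a → PF (+ N)
  gap-above-threshold⇒PF {N = N} above N∉S f<N+a =
    (λ N∈ℤS → N∉S (∈ℤ⇒∈S N∈ℤS)) ,
    λ s s∈S s≢0 → N + s , refl , above (N + s) (<-≤-trans f<N+a (+-monoʳ-≤ N (∈S⇒≥a s∈S s≢0)))

  inadmissible⇒3n≤1+m : ∀ {n m} → ¬ Admissible n m → 3 * n ≤ suc m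
  inadmissible⇒3n≤1+m {n} {m} ¬adm with m ≤? 3 * n
  ... | no m≰3n = m≤n⇒m≤1+n (<⇒≤ (≰⇒> m≰3n))
  ... | yes m≤3n = ≤-reflexive (sym (decidable-stable (suc m ≟ 3 * n) λ 1+m≢3n → ¬adm (m≤3n , 1+m≢3n)))

  inadmissible-boundary : ∀ {p m} → ¬ Admissible p m → Admissible (suc p) m →
                          m ≡ 3 * p + 1 ⊎ m ≡ 3 * p + 3 ⊎ suc m ≡ 3 * p
  inadmissible-boundary {p} {m} ¬adm (m≤3p+3 , 1+m≢3p+3) with m ≤? 3 * p
  ... | yes m≤3p = inj₂ (inj₂ (decidable-stable (suc m ≟ 3 * p) λ 1+m≢3p → ¬adm (m≤3p , 1+m≢3p)))
  ... | no m≰3p with m≤n⇒∃[o]m+o≡n (≰⇒> m≰3p)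
  ...   | 0 , refl = inj₁ (solve (p ∷ []))
  ...   | 1 , refl = ⊥-elim (1+m≢3p+3 (solve (p ∷ [])))
  ...   | 2 , refl = inj₂ (inj₁ (solve (p ∷ [])))
  ...   | suc (suc (suc t)) , refl = contradiction m≤3p+3 (<⇒≱ (begin-strict
    3 * suc p  ≡⟨ solve (p ∷ []) ⟩
    suc (3 * p) + 2  <⟨ +-monoʳ-< (suc (3 * p)) (s≤s (s≤s (s≤s z≤n))) ⟩
    suc (3 * p) + (3 + t)  ∎))

  inadmissibleRow : ℕ → List ℕ
  inadmissibleRow zero = interval 1 a
  inadmissibleRow (suc p) = 3 * p + 2 ∷ interval (3 * p + 4) a

  ∈-inadmissibleRow⁺ : ∀ {n m} → m < a → ¬ Admissible n m → m ∈ inadmissibleRow n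
  ∈-inadmissibleRow⁺ {zero} {zero} _ ¬adm = contradiction (z≤n , λ ()) ¬adm
  ∈-inadmissibleRow⁺ {zero} {suc m} m<a _ = ∈-interval⁺ (s≤s z≤n) m<a
  ∈-inadmissibleRow⁺ {suc p} {m} m<a ¬adm with 3 * p + 4 ≤? m
  ... | yes 3p+4≤m = there (∈-interval⁺ 3p+4≤m m<a)
  ... | no 3p+4≰m =
    here (decidable-stable (m ≟ 3 * p + 2) λ m≢3p+2 → ¬adm (m≤3[1+p] , 1+m≢3[1+p] m≢3p+2))
    where
    m≤3[1+p] : m ≤ 3 * suc p
    m≤3[1+p] = s≤s⁻¹ (subst (m <_) (3p+4≡1+3[1+p] p) (≰⇒> 3p+4≰m))
    1+m≢3[1+p] : m ≢ 3 * p + 2 → suc m ≢ 3 * suc p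
    1+m≢3[1+p] m≢3p+2 eq = m≢3p+2 (suc-injective (trans eq (sym (1+[3p+2]≡3[1+p] p))))

  ∈-inadmissibleRow⁻ : ∀ n {m} → 3 * n < a → m ∈ inadmissibleRow n → m < a × ¬ Admissible n m
  ∈-inadmissibleRow⁻ zero _ m∈ with 1≤m , m<a ← ∈-interval⁻ m∈ =
    m<a , λ (m≤0 , _) → <⇒≱ 1≤m m≤0
  ∈-inadmissibleRow⁻ (suc p) 3[1+p]<a (here refl) =
    <-trans (3p+2<3[1+p] p) 3[1+p]<a , λ (_ , 1+m≢3[1+p]) → 1+m≢3[1+p] (1+[3p+2]≡3[1+p] p)
  ∈-inadmissibleRow⁻ (suc p) _ (there m∈) with 3p+4≤m , m<a ← ∈-interval⁻ m∈ =
    m<a , λ (m≤3[1+p] , _) → <⇒≱ (<-≤-trans (3[1+p]<3p+4 p) 3p+4≤m) m≤3[1+p]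

  inadmissibleRow-unique : ∀ n → Unique (inadmissibleRow n)
  inadmissibleRow-unique zero = interval-unique 1 a
  inadmissibleRow-unique (suc p) = ¬Any⇒All¬ _ 3p+2∉ ∷ interval-unique (3 * p + 4) a
    where
    3p+2∉ : 3 * p + 2 ∉ interval (3 * p + 4) a
    3p+2∉ 3p+2∈ = <⇒≱ (<-trans (3p+2<3[1+p] p) (3[1+p]<3p+4 p)) (proj₁ (∈-interval⁻ 3p+2∈))

  gapRow : ℕ → List ℕ
  gapRow n = map (λ m → n * a + 2 * m) (inadmissibleRow n)

  gapRows : ℕ → List ℕ
  gapRows zero = gapRow 0
  gapRows (suc n) = gapRows n ++ gapRow (suc n)

  ∈-gapRows⁺ : ∀ {n k m} → k ≤ n → m ∈ inadmissibleRow k → k * a + 2 * m ∈ gapRows n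
  ∈-gapRows⁺ {zero} z≤n m∈ = ∈-map⁺ (λ m → 0 * a + 2 * m) m∈
  ∈-gapRows⁺ {suc n} {k} k≤1+n m∈ with m≤n⇒m<n∨m≡n k≤1+n
  ... | inj₁ k<1+n = ∈-++⁺ˡ (∈-gapRows⁺ (s≤s⁻¹ k<1+n) m∈)
  ... | inj₂ refl = ∈-++⁺ʳ (gapRows n) (∈-map⁺ (λ m → suc n * a + 2 * m) m∈)

  ∈-gapRows⁻ : ∀ {n x} → x ∈ gapRows n →
               ∃₂ λ k m → k ≤ n × m ∈ inadmissibleRow k × k * a + 2 * m ≡ x
  ∈-gapRows⁻ {zero} x∈ with m , m∈ , eq ← ∈-map⁻ (λ m → 0 * a + 2 * m) x∈ =
    0 , m , z≤n , m∈ , sym eq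
  ∈-gapRows⁻ {suc n} x∈ with ∈-++⁻ (gapRows n) x∈
  ... | inj₁ x∈′ with k , m , k≤n , m∈ , eq ← ∈-gapRows⁻ x∈′ =
    k , m , m≤n⇒m≤1+n k≤n , m∈ , eq
  ... | inj₂ x∈′ with m , m∈ , eq ← ∈-map⁻ (λ m → suc n * a + 2 * m) x∈′ =
    suc n , m , ≤-refl , m∈ , sym eq

  length-gapRow-zero : length (gapRow 0) ≡ a ∸ 1
  length-gapRow-zero = trans (length-map _ (inadmissibleRow 0)) (length-applyUpTo _ (a ∸ 1))

  length-gapRow-suc : ∀ p → 3 * suc p < a → length (gapRow (suc p)) + 3 * suc p ≡ a
  length-gapRow-suc p 3[1+p]<a = begin-equality
    length (gapRow (suc p)) + 3 * suc p
      ≡⟨ cong (_+ 3 * suc p) (trans (length-map _ (inadmissibleRow (suc p)))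
                                    (cong suc (length-applyUpTo _ (a ∸ (3 * p + 4))))) ⟩
    suc (a ∸ (3 * p + 4)) + 3 * suc p  ≡⟨ regroup (a ∸ (3 * p + 4)) ⟩
    a ∸ (3 * p + 4) + (3 * p + 4)  ≡⟨ m∸n+n≡m 3p+4≤a ⟩
    a  ∎
    where
    regroup : ∀ x → suc x + 3 * suc p ≡ x + (3 * p + 4)
    regroup x = solve (x ∷ p ∷ [])
    3p+4≤a : 3 * p + 4 ≤ a
    3p+4≤a = subst (_≤ a) (sym (3p+4≡1+3[1+p] p)) 3[1+p]<a

  module Odd {c : ℕ} (a≡1+2c : a ≡ suc (2 * c)) where

    instance
      a-nonZero : NonZero a
      a-nonZero = >-nonZero (subst (0 <_) (sym a≡1+2c) z<s)

    a+2m≢2m′ : ∀ m m′ → a + 2 * m ≢ 2 * m′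
    a+2m≢2m′ m m′ eq = even≢odd m′ (c + m) (sym (begin-equality
      suc (2 * (c + m))  ≡⟨ solve (c ∷ m ∷ []) ⟩
      suc (2 * c) + 2 * m  ≡⟨ cong (_+ 2 * m) (sym a≡1+2c) ⟩
      a + 2 * m  ≡⟨ eq ⟩
      2 * m′  ∎))

    canonical-maximal : ∀ {n m n′ m′} → m < a → n′ * a + 2 * m′ ≡ n * a + 2 * m → n′ ≤ n
    canonical-maximal {n} {m} {n′} {m′} m<a eq = ≮⇒≥ n≮n′
      where
      n≮n′ : n ≮ n′
      n≮n′ n<n′ with d , refl ← m≤n⇒∃[o]m+o≡n n<n′ =
        excess d (+-cancelˡ-≡ (n * a) _ _ (begin-equality
          n * a + ((1 + d) * a + 2 * m′)  ≡⟨ solve (n ∷ d ∷ m′ ∷ a ∷ []) ⟩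
          (suc n + d) * a + 2 * m′  ≡⟨ eq ⟩
          n * a + 2 * m  ∎))
        where
        excess : ∀ d → (1 + d) * a + 2 * m′ ≡ 2 * m → ⊥
        excess zero e = a+2m≢2m′ m′ m (trans (cong (_+ 2 * m′) (sym (*-identityˡ a))) e)
        excess (suc d) e = <⇒≱ m<a (*-cancelˡ-≤ 2 (begin
          2 * a  ≤⟨ m≤m+n (2 * a) (d * a + 2 * m′) ⟩
          2 * a + (d * a + 2 * m′)  ≡⟨ solve (d ∷ m′ ∷ a ∷ []) ⟩
          (2 + d) * a + 2 * m′  ≡⟨ e ⟩
          2 * m  ∎))

    canonical-unique : ∀ {n m n′ m′} → m < a → m′ < a →
                       n * a + 2 * m ≡ n′ * a + 2 * m′ → n ≡ n′
    canonical-unique {n} {m} {n′} {m′} m<a m′<a eq =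
      ≤-antisym (canonical-maximal {n′} {m′} {n} {m} m′<a eq)
                (canonical-maximal {n} {m} {n′} {m′} m<a (sym eq))

    smaller-n⇒larger-m : ∀ {n m n′ m′} → n′ < n → n′ * a + 2 * m′ ≡ n * a + 2 * m → m < m′
    smaller-n⇒larger-m {m = m} {n′} {m′} n′<n eq with d , refl ← m≤n⇒∃[o]m+o≡n n′<n =
      *-cancelˡ-< 2 m m′ (begin-strict
        2 * m  <⟨ m<n+m (2 * m) (<-≤-trans (>-nonZero⁻¹ a) (m≤m+n a (d * a))) ⟩
        (1 + d) * a + 2 * m  ≡⟨ +-cancelˡ-≡ (n′ * a) _ _ (begin-equality
          n′ * a + ((1 + d) * a + 2 * m)  ≡⟨ solve (n′ ∷ d ∷ m ∷ a ∷ []) ⟩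
          (suc n′ + d) * a + 2 * m  ≡⟨ eq ⟨
          n′ * a + 2 * m′  ∎) ⟩
        2 * m′  ∎)

    canonical-admissible : ∀ {n m} → m < a → n * a + 2 * m ∈S → Admissible n m
    canonical-admissible {n} {m} m<a n*a+2m∈S
      with n′ , m′ , adm′ , eq ← ∈S⇒admissible n*a+2m∈S
      with m≤n⇒m<n∨m≡n (canonical-maximal {n} {m} {n′} {m′} m<a eq)
    ... | inj₂ refl = subst (Admissible n) (*-cancelˡ-≡ m′ m 2 (+-cancelˡ-≡ (n * a) _ _ eq)) adm′
    ... | inj₁ n′<n = admissible-if-≤ {n} {m} (begin
      2 + m  ≤⟨ s≤s (smaller-n⇒larger-m n′<n eq) ⟩
      suc m′  ≤⟨ s≤s (proj₁ adm′) ⟩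
      suc (3 * n′)  ≤⟨ *-monoʳ-< 3 n′<n ⟩
      3 * n  ∎)

    odd<a⇒<c : ∀ {j} → suc (2 * j) < a → j < c
    odd<a⇒<c {j} 1+2j<a = *-cancelˡ-< 2 j c (s<s⁻¹ (subst (suc (2 * j) <_) a≡1+2c 1+2j<a))

    <c⇒odd<a : ∀ {j} → j < c → suc (2 * j) < a
    <c⇒odd<a {j} j<c = subst (suc (2 * j) <_) (sym a≡1+2c) (s<s (*-monoʳ-< 2 j<c))

    decompose : ∀ N → (∃ λ j → j < c × N ≡ suc (2 * j))
                    ⊎ (∃₂ λ n m → m < a × n * a + 2 * m ≡ N)
    decompose N with parity (N % a) | N / a | m≡m%n+[m/n]*n N a | m%n<n N a
    ... | j , inj₁ r≡2j | q | N≡r+q*a | r<a =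
      inj₂ (q , j , ≤-<-trans (m≤m+n j (j + 0)) (subst (_< a) r≡2j r<a) ,
            trans (+-comm (q * a) (2 * j)) (trans (cong (_+ q * a) (sym r≡2j)) (sym N≡r+q*a)))
    ... | j , inj₂ r≡1+2j | zero | N≡r+q*a | r<a =
      inj₁ (j , odd<a⇒<c (subst (_< a) r≡1+2j r<a) , trans N≡r+q*a (trans (+-identityʳ _) r≡1+2j))
    ... | j , inj₂ r≡1+2j | suc q | N≡r+q*a | r<a =
      inj₂ (q , suc (c + j) , 1+c+j<a , (begin-equality
        q * a + 2 * suc (c + j)  ≡⟨ solve (q ∷ c ∷ j ∷ a ∷ []) ⟩
        suc (2 * j) + (q * a + suc (2 * c))
          ≡⟨ cong₂ (λ r t → r + (q * a + t)) (sym r≡1+2j) (sym a≡1+2c) ⟩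
        N % a + (q * a + a)  ≡⟨ cong (λ t → N % a + t) (+-comm (q * a) a) ⟩
        N % a + suc q * a  ≡⟨ sym N≡r+q*a ⟩
        N  ∎))
      where
      1+c+j<a : suc (c + j) < a
      1+c+j<a = subst (suc (c + j) <_)
                  (trans (cong (λ t → suc (c + t)) (sym (+-identityʳ c))) (sym a≡1+2c))
                  (s<s (+-monoʳ-< c (odd<a⇒<c (subst (_< a) r≡1+2j r<a))))

    a≢0 : a ≢ 0
    a≢0 a≡0 = 1+n≢0 (trans (sym a≡1+2c) a≡0)

    gap+a∈S⇒canonical : ∀ {N} → ¬ N ∈S → N + a ∈S →
      ∃₂ λ p m → p * a + 2 * m ≡ N × m < a × ¬ Admissible p m × Admissible (suc p) m
    gap+a∈S⇒canonical {N} N∉S N+a∈S with decompose (N + a)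
    ... | inj₁ (j , j<c , N+a≡1+2j) =
      ⊥-elim (<⇒≱ (subst (_< a) (sym N+a≡1+2j) (<c⇒odd<a j<c)) (m≤n+m a N))
    ... | inj₂ (zero , m , m<a , eq) = ⊥-elim (a≢0 (m+n≡0⇒n≡0 N (begin-equality
      N + a  ≡⟨ eq ⟨
      2 * m
        ≡⟨ cong (2 *_) (n≤0⇒n≡0 (proj₁ (canonical-admissible {0} m<a (subst _∈S (sym eq) N+a∈S)))) ⟩
      0  ∎)))
    ... | inj₂ (suc p , m , m<a , eq) = p , m , p*a+2m≡N , m<a , ¬adm , adm
      where
      p*a+2m≡N : p * a + 2 * m ≡ N
      p*a+2m≡N = +-cancelˡ-≡ a _ _ (trans (sym (+-assoc a (p * a) (2 * m))) (trans eq (+-comm N a)))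
      ¬adm : ¬ Admissible p m
      ¬adm adm = N∉S (subst _∈S p*a+2m≡N (admissible⇒∈S p m adm))
      adm : Admissible (suc p) m
      adm = canonical-admissible {suc p} m<a (subst _∈S (sym eq) N+a∈S)

    data Boundary (p m : ℕ) : Set where
      at3p+1 : m ≡ 3 * p + 1 → a ≡ m + 1 → Boundary p m
      at3p+3 : m ≡ 3 * p + 3 → a ≡ m + 1 → Boundary p m
      at3p-1 : suc m ≡ 3 * p → a ≤ m + 3 → Boundary p m

    PF⇒boundary : ∀ {N} → PF (+ N) → ∃₂ λ p m → p * a + 2 * m ≡ N × m < a × Boundary p m
    PF⇒boundary {N} (N∉ℤS , shift) =
      boundary (gap+a∈S⇒canonical (λ N∈S → N∉ℤS (N , refl , N∈S)) (N+s∈S a∈S a≢0))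
      where
      N+s∈S : ∀ {s} → s ∈S → s ≢ 0 → N + s ∈S
      N+s∈S {s} s∈S s≢0 = ∈ℤ⇒∈S (shift s s∈S s≢0)
      boundary : (∃₂ λ p m → p * a + 2 * m ≡ N × m < a × ¬ Admissible p m × Admissible (suc p) m) →
                 ∃₂ λ p m → p * a + 2 * m ≡ N × m < a × Boundary p m
      boundary (p , m , p*a+2m≡N , m<a , ¬adm , adm) =
        p , m , p*a+2m≡N , m<a , cases (inadmissible-boundary ¬adm adm)
        where
        carry : ∀ j → N + (a + 2 * j) ∈S → ¬ Admissible (suc p) (m + j) → a ≤ m + j
        carry j N+a+2j∈S ¬adm′ =
          ≮⇒≥ λ m+j<a → ¬adm′ (canonical-admissible {suc p} m+j<a (subst _∈S eq N+a+2j∈S))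
          where
          eq : N + (a + 2 * j) ≡ suc p * a + 2 * (m + j)
          eq = begin-equality
            N + (a + 2 * j)  ≡⟨ +-assoc N a (2 * j) ⟨
            N + a + 2 * j  ≡⟨ cong (λ t → t + a + 2 * j) p*a+2m≡N ⟨
            p * a + 2 * m + a + 2 * j  ≡⟨ solve (p ∷ m ∷ j ∷ a ∷ []) ⟩
            suc p * a + 2 * (m + j)  ∎
        a≡m+1 : ¬ Admissible (suc p) (m + 1) → a ≡ m + 1
        a≡m+1 ¬adm′ =
          ≤-antisym (carry 1 (N+s∈S a+2∈S (m+1+n≢0 a)) ¬adm′) (subst (_≤ a) (+-comm 1 m) m<a)
        cases : m ≡ 3 * p + 1 ⊎ m ≡ 3 * p + 3 ⊎ suc m ≡ 3 * p → Boundary p m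
        cases (inj₁ refl) = at3p+1 refl (a≡m+1 λ (_ , ≢) → ≢ (solve (p ∷ [])))
        cases (inj₂ (inj₁ refl)) = at3p+3 refl (a≡m+1 λ (≤ , _) →
          <⇒≱ (subst (3 * suc p <_) (sym (+-assoc (3 * p) 3 1)) (3[1+p]<3p+4 p)) ≤)
        cases (inj₂ (inj₂ 1+m≡3p)) = at3p-1 1+m≡3p (carry 3 (N+s∈S a+6∈S (m+1+n≢0 a)) λ (_ , ≢) →
          ≢ (trans (cong (_+ 3) 1+m≡3p) (trans (+-comm (3 * p) 3) (sym (*-suc 3 p)))))

    gapRows-unique : ∀ n → 3 * n < a → Unique (gapRows n)
    gapRows-unique zero _ = map⁺ (λ eq → *-cancelˡ-≡ _ _ 2 eq) (inadmissibleRow-unique 0)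
    gapRows-unique (suc n) 3[1+n]<a =
      ++⁺ (gapRows-unique n (<-trans (*-monoʳ-< 3 (n<1+n n)) 3[1+n]<a))
          (map⁺ (λ eq → *-cancelˡ-≡ _ _ 2 (+-cancelˡ-≡ (suc n * a) _ _ eq))
                (inadmissibleRow-unique (suc n)))
          disjoint
      where
      disjoint : ∀ {x} → ¬ (x ∈ gapRows n × x ∈ gapRow (suc n))
      disjoint (x∈ , x∈′)
        with k , m , k≤n , m∈ , eq ← ∈-gapRows⁻ {n} x∈
           | m′ , m′∈ , eq′ ← ∈-map⁻ (λ m → suc n * a + 2 * m) x∈′ =
        <⇒≱ (s≤s k≤n) (≤-reflexive (sym (canonical-unique {k} {m} {suc n} {m′}
          (proj₁ (∈-inadmissibleRow⁻ k (≤-<-trans (*-monoʳ-≤ 3 (m≤n⇒m≤1+n k≤n)) 3[1+n]<a) m∈))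
          (proj₁ (∈-inadmissibleRow⁻ (suc n) 3[1+n]<a m′∈)) (trans eq eq′))))

    -- Row 0 has a − 1 entries and row n > 0 has a − 3n; the sum is doubled to avoid halving 3n(n+1).
    length-gapRows : ∀ n → 3 * n < a → 2 * length (gapRows n) + 3 * n * suc n ≡ 2 * (2 * c + n * a)
    length-gapRows zero _ = begin-equality
      2 * length (gapRow 0) + 0
        ≡⟨ cong (λ t → 2 * t + 0) (trans length-gapRow-zero (cong (_∸ 1) a≡1+2c)) ⟩
      2 * (2 * c) + 0  ≡⟨ solve (c ∷ []) ⟩
      2 * (2 * c + 0 * a)  ∎
    length-gapRows (suc n) 3[1+n]<a = begin-equality
      2 * length (gapRows n ++ gapRow (suc n)) + 3 * suc n * suc (suc n)
        ≡⟨ cong (λ t → 2 * t + 3 * suc n * suc (suc n)) (length-++ (gapRows n)) ⟩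
      2 * (length (gapRows n) + length (gapRow (suc n))) + 3 * suc n * suc (suc n)
        ≡⟨ regroup (length (gapRows n)) (length (gapRow (suc n))) ⟩
      (2 * length (gapRows n) + 3 * n * suc n) + 2 * (length (gapRow (suc n)) + 3 * suc n)
        ≡⟨ cong₂ (λ s t → s + 2 * t) (length-gapRows n 3n<a) (length-gapRow-suc n 3[1+n]<a) ⟩
      2 * (2 * c + n * a) + 2 * a  ≡⟨ solve (c ∷ n ∷ a ∷ []) ⟩
      2 * (2 * c + suc n * a)  ∎
      where
      3n<a : 3 * n < a
      3n<a = <-trans (*-monoʳ-< 3 (n<1+n n)) 3[1+n]<a
      regroup : ∀ L R → 2 * (L + R) + 3 * suc n * suc (suc n)
                      ≡ (2 * L + 3 * n * suc n) + 2 * (R + 3 * suc n)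
      regroup L R = solve (L ∷ R ∷ n ∷ [])

    oddsBelow : List ℕ
    oddsBelow = applyUpTo (λ j → suc (2 * j)) c

    oddsBelow-unique : Unique oddsBelow
    oddsBelow-unique = applyUpTo⁺₁ _ c λ i<j _ eq → <⇒≢ i<j (*-cancelˡ-≡ _ _ 2 (suc-injective eq))

    odd-below-a≢canonical : ∀ {j n m} → j < c → n * a + 2 * m ≢ suc (2 * j)
    odd-below-a≢canonical {j} {zero} {m} _ eq = even≢odd m j eq
    odd-below-a≢canonical {j} {suc n} {m} j<c eq =
      <⇒≱ (<c⇒odd<a j<c) (subst (a ≤_) eq (≤-trans (m≤m+n a (n * a)) (m≤m+n _ (2 * m))))

    gaps : ℕ → List ℕ
    gaps n = oddsBelow ++ gapRows n

    gaps-unique : ∀ n → 3 * n < a → Unique (gaps n)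
    gaps-unique n 3n<a = ++⁺ oddsBelow-unique (gapRows-unique n 3n<a) λ (x∈odds , x∈rows) →
      let j , j<c , x≡ = ∈-applyUpTo⁻ (λ j → suc (2 * j)) x∈odds
          k , m , _ , _ , eq = ∈-gapRows⁻ {n} x∈rows
      in odd-below-a≢canonical {j} {k} {m} j<c (trans eq x≡)

    ∈-gaps⇔∉S : ∀ n → 3 * n < a → a ≤ 3 * n + 2 → ∀ x → x ∈ gaps n ⇔ (¬ x ∈S)
    ∈-gaps⇔∉S n 3n<a a≤3n+2 x = mk⇔ to from
      where
      to : x ∈ gaps n → ¬ x ∈S
      to x∈ with ∈-++⁻ oddsBelow x∈
      ... | inj₁ x∈odds with j , j<c , refl ← ∈-applyUpTo⁻ (λ j → suc (2 * j)) x∈odds =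
        λ x∈S → <⇒≱ (<c⇒odd<a j<c) (∈S⇒≥a x∈S λ ())
      ... | inj₂ x∈rows with k , m , k≤n , m∈ , eq ← ∈-gapRows⁻ {n} x∈rows =
        let m<a , ¬adm = ∈-inadmissibleRow⁻ k (≤-<-trans (*-monoʳ-≤ 3 k≤n) 3n<a) m∈
        in λ x∈S → ¬adm (canonical-admissible {k} m<a (subst _∈S (sym eq) x∈S))
      from : ¬ x ∈S → x ∈ gaps n
      from x∉S with decompose x
      ... | inj₁ (j , j<c , refl) = ∈-++⁺ˡ (∈-applyUpTo⁺ (λ j → suc (2 * j)) j<c)
      ... | inj₂ (k , m , m<a , refl) =
        ∈-++⁺ʳ oddsBelow (∈-gapRows⁺ {n} {k} k≤n (∈-inadmissibleRow⁺ {k} m<a ¬adm))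
        where
        ¬adm : ¬ Admissible k m
        ¬adm adm = x∉S (admissible⇒∈S k m adm)
        k≤n : k ≤ n
        k≤n = s≤s⁻¹ (*-cancelˡ-< 3 k (suc n) (begin-strict
          3 * k  ≤⟨ inadmissible⇒3n≤1+m {k} ¬adm ⟩
          suc m  ≤⟨ m<a ⟩
          a  ≤⟨ a≤3n+2 ⟩
          3 * n + 2  <⟨ 3p+2<3[1+p] n ⟩
          3 * suc n  ∎))

    gaps-genus : ∀ n → 3 * n < a → a ≤ 3 * n + 2 → HasGenus a (a + 2) (a + 6) (c + length (gapRows n))
    gaps-genus n 3n<a a≤3n+2 =
      gaps n , gaps-unique n 3n<a , ∈-gaps⇔∉S n 3n<a a≤3n+2 ,
      trans (length-++ oddsBelow) (cong (_+ length (gapRows n)) (length-applyUpTo _ c))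

module ⟨6k+5,6k+7,6k+11⟩ (k : ℕ) where

  a≡1+2[3k+2] : 6 * k + 5 ≡ suc (2 * (3 * k + 2))
  a≡1+2[3k+2] = solve (k ∷ [])

  open Semigroup (6 * k + 5)
  open Odd {3 * k + 2} a≡1+2[3k+2]

  F≡ : (2 * k + 1) * (6 * k + 5) + 2 * (6 * k + 4) ≡ 12 * k * k + 28 * k + 13
  F≡ = solve (k ∷ [])

  F′≡ : (2 * k + 1) * (6 * k + 5) + 2 * (6 * k + 2) ≡ 12 * k * k + 28 * k + 9
  F′≡ = solve (k ∷ [])

  6k+4<6k+5 : 6 * k + 4 < 6 * k + 5
  6k+4<6k+5 = +-monoʳ-< (6 * k) ≤-refl

  F∉S : ¬ 12 * k * k + 28 * k + 13 ∈S
  F∉S F∈S =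
    <⇒≱ 3[2k+1]<6k+4 (proj₁ (canonical-admissible {2 * k + 1} 6k+4<6k+5 (subst _∈S (sym F≡) F∈S)))
    where
    3[2k+1]<6k+4 : 3 * (2 * k + 1) < 6 * k + 4
    3[2k+1]<6k+4 = ≤-reflexive (solve (k ∷ []))

  F′∉S : ¬ 12 * k * k + 28 * k + 9 ∈S
  F′∉S F′∈S =
    proj₂ (canonical-admissible {2 * k + 1} 6k+2<6k+5 (subst _∈S (sym F′≡) F′∈S)) (solve (k ∷ []))
    where
    6k+2<6k+5 : 6 * k + 2 < 6 * k + 5
    6k+2<6k+5 = +-monoʳ-< (6 * k) (s≤s (s≤s (s≤s z≤n)))

  above-F : ∀ N → 12 * k * k + 28 * k + 13 < N → N ∈S
  above-F N F<N with decompose N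
  ... | inj₁ (j , j<c , refl) = ⊥-elim (<⇒≱ (<c⇒odd<a j<c) (≤-trans a≤F (<⇒≤ F<N)))
    where
    a≤F : 6 * k + 5 ≤ 12 * k * k + 28 * k + 13
    a≤F = subst (6 * k + 5 ≤_) regroup (m≤n+m (6 * k + 5) (12 * k * k + 22 * k + 8))
      where
      regroup : 12 * k * k + 22 * k + 8 + (6 * k + 5) ≡ 12 * k * k + 28 * k + 13
      regroup = solve (k ∷ [])
  ... | inj₂ (n , m , m<a , refl) with n ≤? 2 * k + 1
  ...   | yes n≤2k+1 = ⊥-elim (<⇒≱ F<N (begin
    n * (6 * k + 5) + 2 * m
      ≤⟨ +-mono-≤ (*-monoˡ-≤ (6 * k + 5) n≤2k+1) (*-monoʳ-≤ 2 m≤6k+4) ⟩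
    (2 * k + 1) * (6 * k + 5) + 2 * (6 * k + 4)  ≡⟨ F≡ ⟩
    12 * k * k + 28 * k + 13  ∎))
    where
    m≤6k+4 : m ≤ 6 * k + 4
    m≤6k+4 = s≤s⁻¹ (subst (m <_) (+-suc (6 * k) 4) m<a)
  ...   | no n≰2k+1 = admissible⇒∈S n m (admissible-if-≤ {n} (begin
    2 + m  ≤⟨ s≤s m<a ⟩
    suc (6 * k + 5)  ≡⟨ solve (k ∷ []) ⟩
    3 * suc (2 * k + 1)  ≤⟨ *-monoʳ-≤ 3 (≰⇒> n≰2k+1) ⟩
    3 * n  ∎))

  at3p+1⇒F : ∀ p → 6 * k + 5 ≡ 3 * p + 1 + 1 →
             p * (6 * k + 5) + 2 * (3 * p + 1) ≡ 12 * k * k + 28 * k + 13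
  at3p+1⇒F p eq =
    subst (λ q → q * (6 * k + 5) + 2 * (3 * q + 1) ≡ 12 * k * k + 28 * k + 13) (sym p≡2k+1)
          (solve (k ∷ []))
    where
    p≡2k+1 : p ≡ 2 * k + 1
    p≡2k+1 = *-cancelˡ-≡ p (2 * k + 1) 3 (+-cancelʳ-≡ 2 _ _ (begin-equality
      3 * p + 2  ≡⟨ +-assoc (3 * p) 1 1 ⟨
      3 * p + 1 + 1  ≡⟨ eq ⟨
      6 * k + 5  ≡⟨ solve (k ∷ []) ⟩
      3 * (2 * k + 1) + 2  ∎))

  ¬at3p+3 : ∀ p → 6 * k + 5 ≢ 3 * p + 3 + 1
  ¬at3p+3 p eq = offset≢multiple 3 z<s (s≤s (s≤s z≤n)) (2 * k) p (+-cancelʳ-≡ 4 _ _ (begin-equality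
    3 * (2 * k) + 1 + 4  ≡⟨ solve (k ∷ []) ⟩
    6 * k + 5  ≡⟨ eq ⟩
    3 * p + 3 + 1  ≡⟨ solve (p ∷ []) ⟩
    3 * p + 4  ∎))

  at3p-1⇒F′ : ∀ p m → suc m ≡ 3 * p → 6 * k + 5 ≤ m + 3 → m < 6 * k + 5 →
                p * (6 * k + 5) + 2 * m ≡ 12 * k * k + 28 * k + 9
  at3p-1⇒F′ p m 1+m≡3p a≤m+3 m<a with t , a+t≡m+3 ← m≤n⇒∃[o]m+o≡n a≤m+3 =
    by-offset t 3p≡3[2k+1]+t t<3
    where
    t<3 : t < 3
    t<3 = +-cancelˡ-< (6 * k + 5) t 3 (subst (_< 6 * k + 5 + 3) (sym a+t≡m+3) (+-monoˡ-< 3 m<a))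
    3p≡3[2k+1]+t : 3 * p ≡ 3 * (2 * k + 1) + t
    3p≡3[2k+1]+t = +-cancelʳ-≡ 2 _ _ (begin-equality
      3 * p + 2  ≡⟨ cong (_+ 2) 1+m≡3p ⟨
      suc m + 2  ≡⟨ +-suc m 2 ⟨
      m + 3  ≡⟨ a+t≡m+3 ⟨
      6 * k + 5 + t  ≡⟨ solve (k ∷ t ∷ []) ⟩
      3 * (2 * k + 1) + t + 2  ∎)
    by-offset : ∀ t → 3 * p ≡ 3 * (2 * k + 1) + t → t < 3 →
                p * (6 * k + 5) + 2 * m ≡ 12 * k * k + 28 * k + 9
    by-offset 0 e _ = begin-equality
      p * (6 * k + 5) + 2 * m  ≡⟨ cong₂ (λ q r → q * (6 * k + 5) + 2 * r) p≡2k+1 m≡6k+2 ⟩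
      (2 * k + 1) * (6 * k + 5) + 2 * (6 * k + 2)  ≡⟨ F′≡ ⟩
      12 * k * k + 28 * k + 9  ∎
      where
      p≡2k+1 : p ≡ 2 * k + 1
      p≡2k+1 = *-cancelˡ-≡ p (2 * k + 1) 3 (trans e (+-identityʳ _))
      m≡6k+2 : m ≡ 6 * k + 2
      m≡6k+2 = suc-injective (begin-equality
        suc m  ≡⟨ 1+m≡3p ⟩
        3 * p  ≡⟨ cong (3 *_) p≡2k+1 ⟩
        3 * (2 * k + 1)  ≡⟨ solve (k ∷ []) ⟩
        suc (6 * k + 2)  ∎)
    by-offset 1 e _ = ⊥-elim (offset≢multiple 3 z<s (s≤s (s≤s z≤n)) (2 * k + 1) p (sym e))
    by-offset 2 e _ = ⊥-elim (offset≢multiple 3 z<s ≤-refl (2 * k + 1) p (sym e))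
    by-offset (suc (suc (suc _))) _ (s≤s (s≤s (s≤s ())))

  boundary-value : ∀ {p m} → m < 6 * k + 5 → Boundary p m →
    p * (6 * k + 5) + 2 * m ≡ 12 * k * k + 28 * k + 9 ⊎ p * (6 * k + 5) + 2 * m ≡ 12 * k * k + 28 * k + 13
  boundary-value {p} _ (at3p+1 refl a≡m+1) = inj₂ (at3p+1⇒F p a≡m+1)
  boundary-value {p} _ (at3p+3 refl a≡m+1) = ⊥-elim (¬at3p+3 p a≡m+1)
  boundary-value {p} {m} m<a (at3p-1 1+m≡3p a≤m+3) = inj₁ (at3p-1⇒F′ p m 1+m≡3p a≤m+3 m<a)

  PF⇒F′⊎F : ∀ x → PF x → x ≡ + (12 * k * k + 28 * k + 9) ⊎ x ≡ + (12 * k * k + 28 * k + 13)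
  PF⇒F′⊎F -[1+ j ] pf = ⊥-elim (PF-nonnegative 2<6k+5 j pf)
    where
    2<6k+5 : 2 < 6 * k + 5
    2<6k+5 = ≤-trans (s≤s (s≤s (s≤s z≤n))) (m≤n+m 5 (6 * k))
  PF⇒F′⊎F (+ N) pf =
    let _ , _ , eq , m<a , b = PF⇒boundary pf
    in Sum.map (cong +_ ∘ trans (sym eq)) (cong +_ ∘ trans (sym eq)) (boundary-value m<a b)

  F<F′+a : 12 * k * k + 28 * k + 13 < 12 * k * k + 28 * k + 9 + (6 * k + 5)
  F<F′+a = ≤-trans (m≤m+n (suc (12 * k * k + 28 * k + 13)) (6 * k)) (≤-reflexive regroup)
    where
    regroup : suc (12 * k * k + 28 * k + 13) + 6 * k ≡ 12 * k * k + 28 * k + 9 + (6 * k + 5)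
    regroup = solve (k ∷ [])

  PF-classification : ∀ x → PF x ⇔ (x ≡ + (12 * k * k + 28 * k + 9) ⊎ x ≡ + (12 * k * k + 28 * k + 13))
  PF-classification x = mk⇔ (PF⇒F′⊎F x) λ where
    (inj₁ refl) → gap-above-threshold⇒PF above-F F′∉S F<F′+a
    (inj₂ refl) → gap-above-threshold⇒PF above-F F∉S (m<m+n _ (>-nonZero⁻¹ (6 * k + 5)))

  genus : HasGenus (6 * k + 5) (6 * k + 5 + 2) (6 * k + 5 + 6) (6 * k * k + 16 * k + 8)
  genus = subst (HasGenus (6 * k + 5) (6 * k + 5 + 2) (6 * k + 5 + 6)) count
                (gaps-genus (2 * k + 1) 3[2k+1]<a (≤-reflexive (solve (k ∷ []))))
    where
    3[2k+1]<a : 3 * (2 * k + 1) < 6 * k + 5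
    3[2k+1]<a = subst (_< 6 * k + 5) regroup (+-monoʳ-< (6 * k) (s≤s (s≤s (s≤s (s≤s z≤n)))))
      where
      regroup : 6 * k + 3 ≡ 3 * (2 * k + 1)
      regroup = solve (k ∷ [])
    rows : length (gapRows (2 * k + 1)) ≡ 6 * k * k + 13 * k + 6
    rows = *-cancelˡ-≡ _ _ 2 (+-cancelʳ-≡ (3 * (2 * k + 1) * suc (2 * k + 1)) _ _ (begin-equality
      2 * length (gapRows (2 * k + 1)) + 3 * (2 * k + 1) * suc (2 * k + 1)
        ≡⟨ length-gapRows (2 * k + 1) 3[2k+1]<a ⟩
      2 * (2 * (3 * k + 2) + (2 * k + 1) * (6 * k + 5))
        ≡⟨ solve (k ∷ []) ⟩
      2 * (6 * k * k + 13 * k + 6) + 3 * (2 * k + 1) * suc (2 * k + 1)  ∎))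
    count : 3 * k + 2 + length (gapRows (2 * k + 1)) ≡ 6 * k * k + 16 * k + 8
    count = trans (cong (λ t → 3 * k + 2 + t) rows) (solve (k ∷ []))

corollary10 : (k : ℕ) →
    ((x : ℤ) → IsPF (6 * k + 5) (6 * k + 7) (6 * k + 11) x
        ⇔ ((x ≡ + (12 * k * k + 28 * k + 9)) ⊎ (x ≡ + (12 * k * k + 28 * k + 13))))
    × IsFrobenius (6 * k + 5) (6 * k + 7) (6 * k + 11) (12 * k * k + 28 * k + 13)
    × HasGenus (6 * k + 5) (6 * k + 7) (6 * k + 11) (6 * k * k + 16 * k + 8)
corollary10 k rewrite sym (+-assoc (6 * k) 5 2) | sym (+-assoc (6 * k) 5 6) =
  PF-classification , (F∉S , above-F) , genus
  where open ⟨6k+5,6k+7,6k+11⟩ k
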